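{- If $G$ is a cycle, a path, or a $3$-regular graph and $w\in\left[\frac12,1\right)$, then for every configuration $C_0$ of $G$ the $w$-power index process with initial configuration $C_0$ eventually becomes stable.
   Context: All graphs are finite and simple. A configuration of a graph $G$ is a map $C:V(G)\to\{C,D\}$; vertices with value $C$ are collaborators, those with value $D$ defectors. $N[v]$ is the closed neighbourhood of $v$, $N_C[v]$ is the set of collaborators in $N[v]$ and $N_D[v]$ the set of defectors in $N[v]$. For a win condition $w\in\left[\frac12,1\right)$, the power of $v$ with respect to a configuration is: if $v$ is a collaborator, $p(v)=1/|N_C[v]|$ when $|N_C[v]|/|N[v]|>w$ and $p(v)=0$ otherwise; if $v$ is a defector, $p(v)=1/|N_D[v]|$ when $|N_C[v]|/|N[v]|\le w$ and $p(v)=0$ otherwise. The $w$-power index process with initial configuration $C_0$ produces configurations $C_1,C_2,\dots$: for $t\ge1$ each vertex $v$ simultaneously takes the strategy that, in $C_{t-1}$, is held by the vertex of $N[v]$ of greatest power (powers computed with respect to $C_{t-1}$); if the vertices of $N[v]$ of greatest power have differing strategies, then $C_t(v)=C_{t-1}(v)$. The process becomes stable if there is $i\ge0$ with $C_i=C_{i+1}$. -}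

module Defs where

open import Data.Bool using (Bool; true; false; if_then_else_; _∨_; _∧_; not)
open import Data.Nat as ℕ using (ℕ; zero; suc; _≡ᵇ_; _≥_)
open import Data.Fin using (Fin; toℕ; _≟_)
open import Data.List using (List; []; _∷_; length; filterᵇ; allFin)
open import Data.Integer using (+_)
open import Data.Rational as ℚ using (ℚ; 0ℚ; 1ℚ; ½; _<_; _≤ᵇ_)
open import Data.Product using (Σ; ∃; _×_)
open import Relation.Nullary using (Dec; does; ¬_)
open import Relation.Binary.PropositionalEquality using (_≡_)
open import Function.Bundles using (_↔_; Inverse)

record Graph (n : ℕ) : Set where
  field
    Adj    : Fin n → Fin n → Bool
    sym    : ∀ i j → Adj i j ≡ Adj j i
    irrefl : ∀ i → Adj i i ≡ false
open Graph public

N[_,_] : ∀ {n} → Graph n → Fin n → List (Fin n)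
N[ G , v ] = filterᵇ (λ u → does (u ≟ v) ∨ Adj G v u) (allFin _)

degree : ∀ {n} → Graph n → Fin n → ℕ
degree G v = length (filterᵇ (Adj G v) (allFin _))

cycleAdj : (n : ℕ) → Fin n → Fin n → Bool
cycleAdj n i j =
  (suc (toℕ i) ≡ᵇ toℕ j) ∨ (suc (toℕ j) ≡ᵇ toℕ i)
  ∨ ((toℕ i ≡ᵇ 0) ∧ (suc (toℕ j) ≡ᵇ n))
  ∨ ((toℕ j ≡ᵇ 0) ∧ (suc (toℕ i) ≡ᵇ n))

pathAdj : (n : ℕ) → Fin n → Fin n → Bool
pathAdj n i j = (suc (toℕ i) ≡ᵇ toℕ j) ∨ (suc (toℕ j) ≡ᵇ toℕ i)

IsCycle : ∀ {n} → Graph n → Set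
IsCycle {n} G = (n ≥ 3) × Σ (Fin n ↔ Fin n) λ σ →
  ∀ i j → Adj G i j ≡ cycleAdj n (Inverse.to σ i) (Inverse.to σ j)

IsPath : ∀ {n} → Graph n → Set
IsPath {n} G = (n ≥ 1) × Σ (Fin n ↔ Fin n) λ σ →
  ∀ i j → Adj G i j ≡ pathAdj n (Inverse.to σ i) (Inverse.to σ j)

Is3Regular : ∀ {n} → Graph n → Set
Is3Regular G = ∀ v → degree G v ≡ 3

-- Win condition w ∈ [1/2, 1), w an arbitrary real number, represented
-- by its (open) upper Dedekind cut  Above q  :⇔  q > w.

record WinCondition : Set₁ where
  field
    Above   : ℚ → Set
    above?  : ∀ q → Dec (Above q)
    upward  : ∀ {q r} → q < r → Above q → Above r
    rounded : ∀ {q} → Above q → ∃ λ r → r < q × Above r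
    notHalf : ¬ Above ½      -- w ≥ 1/2
    one     : Above 1ℚ       -- w < 1
open WinCondition public

data Strategy : Set where
  C D : Strategy

isC : Strategy → Bool
isC C = true
isC D = false

isD : Strategy → Bool
isD s = not (isC s)

allᵇ : ∀ {A : Set} → (A → Bool) → List A → Bool
allᵇ p []       = true
allᵇ p (x ∷ xs) = p x ∧ allᵇ p xs

Config : ℕ → Set
Config n = Fin n → Strategy

-- 1/k (k ≥ 1 in all uses; value at 0 irrelevant)
inv : ℕ → ℚ
inv zero    = 0ℚ
inv (suc k) = + 1 ℚ./ suc k

-- a / b (b ≥ 1 in all uses)
ratio : ℕ → ℕ → ℚ
ratio a zero    = 0ℚ
ratio a (suc b) = + a ℚ./ suc b

module _ {n : ℕ} (G : Graph n) (w : WinCondition) (c : Config n) where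

  nC nD nN : Fin n → ℕ
  nC v = length (filterᵇ (λ u → isC (c u)) N[ G , v ])
  nD v = length (filterᵇ (λ u → isD (c u)) N[ G , v ])
  nN v = length N[ G , v ]

  collabWins : Fin n → Bool
  collabWins v = does (above? w (ratio (nC v) (nN v)))

  power : Fin n → ℚ
  power v with c v
  ... | C = if collabWins v then inv (nC v) else 0ℚ
  ... | D = if collabWins v then 0ℚ else inv (nD v)

  maxPowerNbrs : Fin n → List (Fin n)
  maxPowerNbrs v =
    filterᵇ (λ u → allᵇ (λ x → power x ≤ᵇ power u) N[ G , v ]) N[ G , v ]

  step : Config n
  step v =
    if allᵇ (λ u → isC (c u)) (maxPowerNbrs v) then C
    else if allᵇ (λ u → isD (c u)) (maxPowerNbrs v) then D
    else c v

process : ∀ {n} → Graph n → WinCondition → Config n → ℕ → Config n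
process G w c0 zero    = c0
process G w c0 (suc t) = step G w (process G w c0 t)

BecomesStable : ∀ {n} → Graph n → WinCondition → Config n → Set
BecomesStable G w c0 =
  ∃ λ i → ∀ v → process G w c0 i v ≡ process G w c0 (suc i) v

module Submission where

-- Call a vertex safe if it defects and has a defecting neighbour.  Assume
-- every closed neighbourhood has at most three vertices, or every one has
-- exactly four (the graph is "admissible").  Two local facts drive the proof:
--   (1) a safe defector keeps defecting, and so does its defecting
--       neighbour, hence it stays safe;
--   (2) a collaborator that turns into a defector has, in the same round,
--       a neighbour that also ends up defecting, so it is safe at once.
-- Give safe defectors rank 0, collaborators rank 1 and other defectors
-- rank 2.  By (1) and (2) no rank increases in a round, and a vertex whose
-- rank does not change keeps its strategy.  Hence the total rank is a
-- natural number that strictly drops in every round that changes the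
-- configuration, so the process must become stable.

open import Defs
open import Data.Nat using (ℕ)
open import Data.Sum using (_⊎_)

open import Data.Bool using (Bool; true; false; T; not; _∧_; _∨_; if_then_else_)
open import Data.Bool.Properties using (T?; T-∧; T-∨)
open import Data.Empty using (⊥; ⊥-elim)
open import Data.Fin using (Fin; toℕ; _≟_)
open import Data.Fin.Properties using (toℕ-injective; toℕ<n; any?)
open import Data.Integer as ℤ using (+_)
import Data.Integer.Properties as ℤP
open import Data.List using (List; []; _∷_; length; filterᵇ; allFin; map)
open import Data.List.Membership.Propositional using (_∈_; _∉_)
open import Data.List.Membership.Propositional.Properties
  using (∈-filter⁺; ∈-filter⁻; ∈-allFin)
import Data.List.Relation.Unary.All as All
open import Data.List.Relation.Unary.AllPairs using (_∷_)
open import Data.List.Relation.Unary.Any using (here; there)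
open import Data.List.Relation.Unary.Unique.Propositional using (Unique)
open import Data.List.Relation.Unary.Unique.Propositional.Properties
  using (allFin⁺; filter⁺)
open import Data.Nat using (zero; suc; pred; _+_; _*_; _≤_; _<_; z≤n; s≤s; _≡ᵇ_)
import Data.Nat as ℕ
open import Data.Nat.ListAction using (sum)
open import Data.Nat.Properties
  using (≤-refl; ≤-trans; ≤-<-trans; <-≤-trans; ≤-pred; <-irrefl; n≮0; ≮⇒≥; ≰⇒>;
         m≤n⇒m≤1+n; m≤n⇒m<n∨m≡n; +-suc; +-identityʳ; +-mono-≤; +-monoˡ-≤;
         +-mono-<-≤; +-mono-≤-<; +-cancelˡ-<; *-comm; *-identityˡ; *-cancelˡ-<;
         ≡ᵇ⇒≡; ≡⇒≡ᵇ; module ≤-Reasoning)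
open import Data.Product using (∃; ∃-syntax; _×_; _,_; proj₁; proj₂)
open import Data.Rational as ℚ using (ℚ; 0ℚ; ½; _/_)
import Data.Rational.Properties as ℚP
import Data.Rational.Unnormalised as ℚᵘ
import Data.Rational.Unnormalised.Properties as ℚᵘP
open import Data.Sum using (inj₁; inj₂)
open import Function using (_∘_; _↔_; Inverse; Equivalence)
open import Function.Bundles using (Injection)
open import Function.Properties.Inverse using (↔⇒↣)
open import Relation.Binary.Definitions using (DecidableEquality)
open import Relation.Binary.PropositionalEquality as ≡
  using (_≡_; _≢_; refl; cong; subst; subst₂)
open import Relation.Nullary using (¬_; Dec; yes; no; does)
open import Relation.Binary.Bundles using (DecTotalOrder)
open import Relation.Nullary.Decidable using (True; isYes; toWitness; fromWitness; _×-dec_)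
import Data.List.Extrema (DecTotalOrder.totalOrder ℚP.≤-decTotalOrder) as Extrema

count : {A : Set} → (A → Bool) → List A → ℕ
count p xs = length (filterᵇ p xs)

module _ {A : Set} where

  member⇒length≥1 : {x : A} {xs : List A} → x ∈ xs → 1 ≤ length xs
  member⇒length≥1 (here _)  = s≤s z≤n
  member⇒length≥1 (there _) = s≤s z≤n

  members⇒length≥2 : {x y : A} {xs : List A} → x ∈ xs → y ∈ xs → x ≢ y → 2 ≤ length xs
  members⇒length≥2 (here refl) (here refl) x≢y = ⊥-elim (x≢y refl)
  members⇒length≥2 (here _)    (there y∈)  _   = s≤s (member⇒length≥1 y∈)
  members⇒length≥2 (there x∈)  (here _)    _   = s≤s (member⇒length≥1 x∈)
  members⇒length≥2 (there x∈)  (there y∈)  x≢y = m≤n⇒m≤1+n (members⇒length≥2 x∈ y∈ x≢y)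

  count≥1 : (p : A → Bool) {x : A} {xs : List A} → x ∈ xs → T (p x) → 1 ≤ count p xs
  count≥1 p x∈ px = member⇒length≥1 (∈-filter⁺ (T? ∘ p) x∈ px)

  count≥2 : (p : A → Bool) {x y : A} {xs : List A} → x ∈ xs → y ∈ xs → x ≢ y →
            T (p x) → T (p y) → 2 ≤ count p xs
  count≥2 p x∈ y∈ x≢y px py =
    members⇒length≥2 (∈-filter⁺ (T? ∘ p) x∈ px) (∈-filter⁺ (T? ∘ p) y∈ py) x≢y

  count-complement : (p : A → Bool) (xs : List A) →
                     count p xs + count (not ∘ p) xs ≡ length xs
  count-complement p []       = refl
  count-complement p (x ∷ xs) with p x
  ... | true  = cong suc (count-complement p xs)
  ... | false = ≡.trans (+-suc (count p xs) _) (cong suc (count-complement p xs))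

  three-witnesses : (p : A → Bool) {xs : List A} → Unique xs → 3 ≤ count p xs →
    ∃[ a ] ∃[ b ] ∃[ c ] (a ≢ b × a ≢ c × b ≢ c) × (T (p a) × T (p b) × T (p c))
  three-witnesses p {xs} uniq big =
    first-three (filter⁺ (T? ∘ p) uniq) (proj₂ ∘ ∈-filter⁻ (T? ∘ p) {xs = xs}) big
    where
    first-three : ∀ {ys} → Unique ys → (∀ {y} → y ∈ ys → T (p y)) → 3 ≤ length ys →
      ∃[ a ] ∃[ b ] ∃[ c ] (a ≢ b × a ≢ c × b ≢ c) × (T (p a) × T (p b) × T (p c))
    first-three {a ∷ b ∷ c ∷ _} ((a≢b All.∷ a≢c All.∷ _) ∷ (b≢c All.∷ _) ∷ _) pass _ =
      a , b , c , (a≢b , a≢c , b≢c) , (pass (here refl) , pass (there (here refl)) ,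
                                      pass (there (there (here refl))))
    first-three {[]}              _ _ ()
    first-three {_ ∷ []}          _ _ (s≤s ())
    first-three {_ ∷ _ ∷ []}      _ _ (s≤s (s≤s ()))

  allᵇ-sound : (p : A → Bool) (xs : List A) → T (allᵇ p xs) → ∀ {x} → x ∈ xs → T (p x)
  allᵇ-sound p (y ∷ ys) all (here refl) = proj₁ (Equivalence.to T-∧ all)
  allᵇ-sound p (y ∷ ys) all (there x∈)  = allᵇ-sound p ys (proj₂ (Equivalence.to T-∧ all)) x∈

  allᵇ-complete : (p : A → Bool) (xs : List A) → (∀ {x} → x ∈ xs → T (p x)) → T (allᵇ p xs)
  allᵇ-complete p []       _    = _
  allᵇ-complete p (y ∷ ys) pass =
    Equivalence.from T-∧ (pass (here refl) , allᵇ-complete p ys (pass ∘ there))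

module _ {A : Set} (_≟ᴬ_ : DecidableEquality A) where

  count-without : (p : A → Bool) (v : A) {xs : List A} → v ∉ xs →
                  count (λ u → does (u ≟ᴬ v) ∨ p u) xs ≡ count p xs
  count-without p v {[]}     _   = refl
  count-without p v {x ∷ xs} v∉ with x ≟ᴬ v
  ... | yes refl = ⊥-elim (v∉ (here refl))
  ... | no _ with p x
  ...   | true  = cong suc (count-without p v (v∉ ∘ there))
  ...   | false = count-without p v (v∉ ∘ there)

  count-with : (p : A → Bool) (v : A) {xs : List A} → Unique xs → v ∈ xs → ¬ T (p v) →
               count (λ u → does (u ≟ᴬ v) ∨ p u) xs ≡ suc (count p xs)
  count-with p v {x ∷ xs} (x∉xs ∷ _) (here refl) ¬pv with x ≟ᴬ x | p x
  ... | no x≢x | _     = ⊥-elim (x≢x refl)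
  ... | yes _  | true  = ⊥-elim (¬pv _)
  ... | yes _  | false = cong suc (count-without p x (λ x∈ → All.lookup x∉xs x∈ refl))
  count-with p v {x ∷ xs} (x∉xs ∷ uniq) (there v∈) ¬pv with x ≟ᴬ v
  ... | yes refl = ⊥-elim (All.lookup x∉xs v∈ refl)
  ... | no _ with p x
  ...   | true  = cong suc (count-with p v uniq v∈ ¬pv)
  ...   | false = count-with p v uniq v∈ ¬pv

C≢D : C ≢ D
C≢D ()

isC-complete : ∀ {s} → s ≡ C → T (isC s)
isC-complete refl = _

isD-complete : ∀ {s} → s ≡ D → T (isD s)
isD-complete refl = _

isD-sound : ∀ {s} → T (isD s) → s ≡ D
isD-sound {D} _ = refl

_≟D : ∀ s → Dec (s ≡ D)
C ≟D = no C≢D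
D ≟D = yes refl

descent : (P : ℕ → Set) (Φ : ℕ → ℕ) → (∀ t → P t ⊎ Φ (suc t) < Φ t) → ∃ P
descent P Φ progress = go (Φ 0) 0 ≤-refl
  where
  go : ∀ k t → Φ t ≤ k → ∃ P
  go zero t Φt≤0 with progress t
  ... | inj₁ Pt   = t , Pt
  ... | inj₂ drop = ⊥-elim (n≮0 (<-≤-trans drop Φt≤0))
  go (suc k) t Φt≤1+k with progress t
  ... | inj₁ Pt   = t , Pt
  ... | inj₂ drop = go k (suc t) (≤-pred (<-≤-trans drop Φt≤1+k))

module _ {A : Set} (f g : A → ℕ) (f≤g : ∀ x → f x ≤ g x) where

  sum-mono : ∀ xs → sum (map f xs) ≤ sum (map g xs)
  sum-mono []       = z≤n
  sum-mono (x ∷ xs) = +-mono-≤ (f≤g x) (sum-mono xs)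

  sum-dominated : ∀ xs → sum (map f xs) < sum (map g xs) ⊎ (∀ {x} → x ∈ xs → f x ≡ g x)
  sum-dominated [] = inj₂ λ ()
  sum-dominated (x ∷ xs) with m≤n⇒m<n∨m≡n (f≤g x) | sum-dominated xs
  ... | inj₁ fx<gx | _        = inj₁ (+-mono-<-≤ fx<gx (sum-mono xs))
  ... | inj₂ _     | inj₁ Σ<  = inj₁ (+-mono-≤-< (f≤g x) Σ<)
  ... | inj₂ fx≡gx | inj₂ agree = inj₂ λ where
    (here refl) → fx≡gx
    (there x∈)  → agree x∈

-- Fractions are compared by cross-multiplication; + a / suc b is by
-- definition the normalisation of the unnormalised fraction a/(1+b).
frac-≤ : ∀ a b c d → a * suc d ≤ c * suc b → + a / suc b ℚ.≤ + c / suc d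
frac-≤ a b c d ad≤cb = ℚP.toℚᵘ-cancel-≤
  (ℚᵘP.≤-respʳ-≃ (ℚᵘP.≃-sym (ℚP.toℚᵘ-fromℚᵘ (ℚᵘ.mkℚᵘ (+ c) d)))
  (ℚᵘP.≤-respˡ-≃ (ℚᵘP.≃-sym (ℚP.toℚᵘ-fromℚᵘ (ℚᵘ.mkℚᵘ (+ a) b)))
  (ℚᵘ.*≤* (subst₂ ℤ._≤_ (ℤP.pos-* a (suc d)) (ℤP.pos-* c (suc b)) (ℤ.+≤+ ad≤cb)))))

0≤inv : ∀ k → 0ℚ ℚ.≤ inv k
0≤inv zero    = ℚP.≤-refl
0≤inv (suc k) = frac-≤ 0 0 1 k z≤n

inv-antitone : ∀ {a b} → 1 ≤ a → a ≤ b → inv b ℚ.≤ inv a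
inv-antitone {suc a} {suc b} _ a≤b = frac-≤ 1 b 1 a (+-mono-≤ a≤b z≤n)

ratio≤½ : ∀ {a b} → 2 * a ≤ b → ratio a b ℚ.≤ ½
ratio≤½ {a} {zero}  _      = frac-≤ 0 0 1 1 z≤n
ratio≤½ {a} {suc b} 2a≤1+b =
  frac-≤ a b 1 1 (subst₂ _≤_ (*-comm 2 a) (≡.sym (*-identityˡ (suc b))) 2a≤1+b)

≤½⇒¬above : (w : WinCondition) {r : ℚ} → r ℚ.≤ ½ → ¬ Above w r
≤½⇒¬above w r≤½ above with rounded w above
... | r′ , r′<r , above′ = notHalf w (upward w (ℚP.<-≤-trans r′<r r≤½) above′)

collab-majority : (w : WinCondition) (a b : ℕ) →
                  does (above? w (ratio a b)) ≡ true → b < 2 * a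
collab-majority w a b wins with above? w (ratio a b) | b ℕ.<? 2 * a
... | _         | yes b<2a = b<2a
... | yes above | no  b≮2a = ⊥-elim (≤½⇒¬above w (ratio≤½ (≮⇒≥ b≮2a)) above)
collab-majority w a b () | no _ | no _

two-defectors-block-majority : ∀ {a b} → 2 ≤ b → a + b ≤ 4 → ¬ (a + b < 2 * a)
two-defectors-block-majority {a} {b} 2≤b a+b≤4 majority =
  <-irrefl refl (≤-trans (+-mono-≤ 3≤a 2≤b) a+b≤4)
  where
  b<a : b < a
  b<a = subst (b <_) (+-identityʳ a) (+-cancelˡ-< a b (a + 0) majority)
  3≤a : 3 ≤ a
  3≤a = ≤-trans (s≤s 2≤b) b<a

module Neighbourhood {n : ℕ} (G : Graph n) where

  size : Fin n → ℕ
  size v = length N[ G , v ]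

  private
    inN : Fin n → Fin n → Bool
    inN v u = does (u ≟ v) ∨ Adj G v u

  self∈N : ∀ v → v ∈ N[ G , v ]
  self∈N v = ∈-filter⁺ (T? ∘ inN v) (∈-allFin v) v∈
    where
    v∈ : T (inN v v)
    v∈ with v ≟ v
    ... | yes _  = _
    ... | no v≢v = ⊥-elim (v≢v refl)

  adj⇒∈N : ∀ {v u} → T (Adj G v u) → u ∈ N[ G , v ]
  adj⇒∈N adj = ∈-filter⁺ (T? ∘ inN _) (∈-allFin _) (Equivalence.from T-∨ (inj₂ adj))

  adj⇒≢ : ∀ {v u} → T (Adj G v u) → u ≢ v
  adj⇒≢ {v} adj refl = subst T (irrefl G v) adj

  ∈N⇒adj : ∀ {v u} → u ∈ N[ G , v ] → u ≢ v → T (Adj G v u)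
  ∈N⇒adj {v} {u} u∈ u≢v with u ≟ v | proj₂ (∈-filter⁻ (T? ∘ inN v) {xs = allFin n} u∈)
  ... | yes u≡v | _   = ⊥-elim (u≢v u≡v)
  ... | no _    | adj = adj

  adj-sym : ∀ {v u} → T (Adj G v u) → T (Adj G u v)
  adj-sym {v} {u} = subst T (Graph.sym G v u)

  size≥2 : ∀ {v u} → T (Adj G v u) → 2 ≤ size v
  size≥2 adj = members⇒length≥2 (self∈N _) (adj⇒∈N adj) (adj⇒≢ adj ∘ ≡.sym)

  size≡1+degree : ∀ v → size v ≡ suc (degree G v)
  size≡1+degree v =
    count-with _≟_ (Adj G v) v (allFin⁺ n) (∈-allFin v) (subst T (irrefl G v))

Admissible : ∀ {n} → Graph n → Set
Admissible G = (∀ v → size v ≤ 3) ⊎ (∀ v → size v ≡ 4)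
  where open Neighbourhood G

module AdmissibleBounds {n : ℕ} (G : Graph n) where
  open Neighbourhood G

  size≤4 : Admissible G → ∀ v → size v ≤ 4
  size≤4 (inj₁ ≤3) v = m≤n⇒m≤1+n (≤3 v)
  size≤4 (inj₂ ≡4) v = subst (_≤ 4) (≡.sym (≡4 v)) ≤-refl

  -- If a collaborators form a strict majority at a neighbour u of x, then
  -- N[x] has at most a + 1 vertices: with maximum degree two, |N[u]| ≥ 2
  -- forces a ≥ 2; in a cubic graph, 4 < 2a forces a ≥ 3.
  majority-bounds-neighbour : Admissible G → ∀ {x u} → T (Adj G x u) →
                              ∀ a → size u < 2 * a → size x ≤ suc a
  majority-bounds-neighbour (inj₁ ≤3) {x} adj a majority =
    ≤-trans (≤3 x) (s≤s (*-cancelˡ-< 2 1 a (≤-<-trans (size≥2 (adj-sym adj)) majority)))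
  majority-bounds-neighbour (inj₂ ≡4) {x} {u} adj a majority =
    subst (_≤ suc a) (≡.sym (≡4 x)) (s≤s (*-cancelˡ-< 2 2 a (subst (_< 2 * a) (≡4 u) majority)))

module Round {n : ℕ} (G : Graph n) (adm : Admissible G) (w : WinCondition) (c : Config n)
  where
  open Neighbourhood G
  open AdmissibleBounds G

  wins : Fin n → Bool
  wins = collabWins G w c

  pow : Fin n → ℚ
  pow = power G w c

  nc nd : Fin n → ℕ
  nc = nC G w c
  nd = nD G w c

  next : Config n
  next = step G w c

  collab≢defector : ∀ {x y} → c x ≡ C → c y ≡ D → x ≢ y
  collab≢defector cx cy refl = C≢D (≡.trans (≡.sym cx) cy)

  power-winning-C : ∀ {v} → c v ≡ C → wins v ≡ true → pow v ≡ inv (nc v)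
  power-winning-C cv wv rewrite cv | wv = refl

  power-winning-D : ∀ {v} → c v ≡ D → wins v ≡ false → pow v ≡ inv (nd v)
  power-winning-D cv wv rewrite cv | wv = refl

  power-losing-C : ∀ {v} → c v ≡ C → wins v ≡ false → pow v ≡ 0ℚ
  power-losing-C cv wv rewrite cv | wv = refl

  power-losing-D : ∀ {v} → c v ≡ D → wins v ≡ true → pow v ≡ 0ℚ
  power-losing-D cv wv rewrite cv | wv = refl

  power≥0 : ∀ v → 0ℚ ℚ.≤ pow v
  power≥0 v with c v
  ... | C with wins v
  ...   | true  = 0≤inv (nc v)
  ...   | false = ℚP.≤-refl
  power≥0 v | D with wins v
  ...   | true  = ℚP.≤-refl
  ...   | false = 0≤inv (nd v)

  ∈maxPower : ∀ {v u} → u ∈ N[ G , v ] → (∀ {y} → y ∈ N[ G , v ] → pow y ℚ.≤ pow u) →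
              u ∈ maxPowerNbrs G w c v
  ∈maxPower {v} {u} u∈ dominates =
    ∈-filter⁺ (T? ∘ _) u∈ (allᵇ-complete _ N[ G , v ] (ℚP.≤⇒≤ᵇ ∘ dominates))

  best : Fin n → Fin n
  best v = Extrema.argmax pow v N[ G , v ]

  best∈N : ∀ v → best v ∈ N[ G , v ]
  best∈N v with Extrema.argmax-sel pow v N[ G , v ]
  ... | inj₁ best≡v = subst (_∈ N[ G , v ]) (≡.sym best≡v) (self∈N v)
  ... | inj₂ best∈  = best∈

  best-max : ∀ v {y} → y ∈ N[ G , v ] → pow y ℚ.≤ pow (best v)
  best-max v = All.lookup (Extrema.f[xs]≤f[argmax] {f = pow} v N[ G , v ])

  defector-follows : ∀ {v m} → c v ≡ D → m ∈ maxPowerNbrs G w c v → c m ≡ D → next v ≡ D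
  defector-follows {v} cv m∈ cm
    with allᵇ (λ u → isC (c u)) (maxPowerNbrs G w c v)
       | allᵇ-sound (λ u → isC (c u)) (maxPowerNbrs G w c v)
  ... | true  | allC = ⊥-elim (subst (T ∘ isC) cm (allC _ m∈))
  ... | false | _ with allᵇ (λ u → isD (c u)) (maxPowerNbrs G w c v)
  ...   | true  = refl
  ...   | false = cv

  turning-collab : ∀ {v} → c v ≡ C → next v ≡ D →
                   T (allᵇ (λ u → isD (c u)) (maxPowerNbrs G w c v))
  turning-collab {v} cv turned
    with allᵇ (λ u → isC (c u)) (maxPowerNbrs G w c v)
       | allᵇ (λ u → isD (c u)) (maxPowerNbrs G w c v)
  ... | true  | _     = ⊥-elim (C≢D turned)
  ... | false | true  = _
  ... | false | false = ⊥-elim (C≢D (≡.trans (≡.sym cv) turned))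

  -- At a defector where the collaborators lose, no collaborating neighbour
  -- is more powerful: if that neighbour's side wins, the admissibility
  -- bound gives it at least as many collaborators as there are defectors here.
  defector-outweighs-collab : ∀ {x m} → c x ≡ D → wins x ≡ false →
                              m ∈ N[ G , x ] → c m ≡ C → pow m ℚ.≤ pow x
  defector-outweighs-collab {x} {m} cx lose m∈ cm with wins m in wm
  ... | false = subst (ℚ._≤ pow x) (≡.sym (power-losing-C cm wm)) (power≥0 x)
  ... | true  = subst₂ ℚ._≤_ (≡.sym (power-winning-C cm wm)) (≡.sym (power-winning-D cx lose))
                  (inv-antitone (count≥1 (isD ∘ c) (self∈N x) (isD-complete cx)) fewer-defectors)
    where
    open ≤-Reasoning
    adj : T (Adj G x m)
    adj = ∈N⇒adj m∈ (collab≢defector cm cx)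
    fewer-defectors : nd x ≤ nc m
    fewer-defectors = ≤-pred (begin
      suc (nd x)   ≤⟨ +-monoˡ-≤ (nd x) (count≥1 (isC ∘ c) m∈ (isC-complete cm)) ⟩
      nc x + nd x  ≡⟨ count-complement (isC ∘ c) N[ G , x ] ⟩
      size x       ≤⟨ majority-bounds-neighbour adm {u = m} adj (nc m) (collab-majority w _ _ wm) ⟩
      suc (nc m)   ∎)

  losing-collabs⇒defector-stays : ∀ {x} → c x ≡ D → wins x ≡ false → next x ≡ D
  losing-collabs⇒defector-stays {x} cx lose with c (best x) in cb
  ... | D = defector-follows cx (∈maxPower (best∈N x) (best-max x)) cb
  ... | C = defector-follows cx (∈maxPower (self∈N x) x-dominates) cx
    where
    x-dominates : ∀ {y} → y ∈ N[ G , x ] → pow y ℚ.≤ pow x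
    x-dominates y∈ = ℚP.≤-trans (best-max x y∈)
                       (defector-outweighs-collab cx lose (best∈N x) cb)

  -- At a defector with a defecting neighbour the collaborators lose, since
  -- N[x] has at most four vertices, two of them defectors.
  defecting-pair⇒collabs-lose : ∀ {x u} → c x ≡ D → T (Adj G x u) → c u ≡ D → wins x ≡ false
  defecting-pair⇒collabs-lose {x} {u} cx adj cu with wins x in wx
  ... | false = refl
  ... | true  = ⊥-elim (two-defectors-block-majority two-defectors at-most-four majority)
    where
    split : nc x + nd x ≡ size x
    split = count-complement (isC ∘ c) N[ G , x ]
    two-defectors : 2 ≤ nd x
    two-defectors = count≥2 (isD ∘ c) (self∈N x) (adj⇒∈N adj) (adj⇒≢ adj ∘ ≡.sym)
                      (isD-complete cx) (isD-complete cu)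
    at-most-four : nc x + nd x ≤ 4
    at-most-four = subst (_≤ 4) (≡.sym split) (size≤4 adm x)
    majority : nc x + nd x < 2 * nc x
    majority = subst (_< 2 * nc x) (≡.sym split) (collab-majority w _ _ wx)

  safe-defector-stays : ∀ {x u} → c x ≡ D → T (Adj G x u) → c u ≡ D → next x ≡ D
  safe-defector-stays cx adj cu =
    losing-collabs⇒defector-stays cx (defecting-pair⇒collabs-lose cx adj cu)

  -- Its vertex m of greatest power defects; were
  -- the collaborators to win at m, m would have power 0 and the
  -- collaborator itself would be of greatest power.
  turning-collab-has-defecting-nbr : ∀ {v} → c v ≡ C → next v ≡ D →
                                     ∃[ m ] T (Adj G v m) × next m ≡ D
  turning-collab-has-defecting-nbr {v} cv turned = m , adj , m-stays
    where
    m : Fin n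
    m = best v
    all-max-defect : ∀ {u} → u ∈ maxPowerNbrs G w c v → T (isD (c u))
    all-max-defect = allᵇ-sound (λ u → isD (c u)) (maxPowerNbrs G w c v) (turning-collab cv turned)
    cm : c m ≡ D
    cm = isD-sound (all-max-defect (∈maxPower (best∈N v) (best-max v)))
    adj : T (Adj G v m)
    adj = ∈N⇒adj (best∈N v) (collab≢defector cv cm ∘ ≡.sym)
    m-stays : next m ≡ D
    m-stays with wins m in wm
    ... | false = losing-collabs⇒defector-stays cm wm
    ... | true  = ⊥-elim (C≢D (≡.trans (≡.sym cv) (isD-sound (all-max-defect v-max))))
      where
      v-max : v ∈ maxPowerNbrs G w c v
      v-max = ∈maxPower (self∈N v) λ y∈ →
        ℚP.≤-trans (best-max v y∈) (subst (ℚ._≤ pow v) (≡.sym (power-losing-D cm wm)) (power≥0 v))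

-- Rank of a vertex with strategy s; h says whether it has a defecting neighbour.
rankOf : Strategy → Bool → ℕ
rankOf C _     = 1
rankOf D true  = 0
rankOf D false = 2

-- Facts (1) and (2), phrased for one vertex going from (s, h) to (s′, h′),
-- make its rank non-increasing, and an unchanged rank means an unchanged
-- strategy.
rankOf-descent : ∀ s h s′ h′ → (s ≡ D → T h → s′ ≡ D × T h′) → (s ≡ C → s′ ≡ D → T h′) →
                 rankOf s′ h′ ≤ rankOf s h × (rankOf s′ h′ ≡ rankOf s h → s′ ≡ s)
rankOf-descent C _     C _     _    _    = ≤-refl , λ _ → refl
rankOf-descent C _     D true  _    _    = z≤n , λ ()
rankOf-descent C _     D false _    turn = ⊥-elim (turn refl refl)
rankOf-descent D true  C _     safe _    = ⊥-elim (C≢D (proj₁ (safe refl _)))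
rankOf-descent D true  D true  _    _    = ≤-refl , λ _ → refl
rankOf-descent D true  D false safe _    = ⊥-elim (proj₂ (safe refl _))
rankOf-descent D false C _     _    _    = s≤s z≤n , λ ()
rankOf-descent D false D true  _    _    = z≤n , λ ()
rankOf-descent D false D false _    _    = ≤-refl , λ _ → refl

module Potential {n : ℕ} (G : Graph n) (adm : Admissible G) (w : WinCondition) where
  open Neighbourhood G using (adj-sym)

  DefectingNbr : Config n → Fin n → Set
  DefectingNbr c v = ∃[ u ] T (Adj G v u) × c u ≡ D

  defectingNbr? : ∀ c v → Dec (DefectingNbr c v)
  defectingNbr? c v = any? λ u → T? (Adj G v u) ×-dec (c u ≟D)

  rank : Config n → Fin n → ℕ
  rank c v = rankOf (c v) (isYes (defectingNbr? c v))

  rank-step : ∀ c v → rank (step G w c) v ≤ rank c v ×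
                      (rank (step G w c) v ≡ rank c v → step G w c v ≡ c v)
  rank-step c v = rankOf-descent (c v) _ (next v) _ stays-safe becomes-safe
    where
    open Round G adm w c
    stays-safe : c v ≡ D → True (defectingNbr? c v) →
                 next v ≡ D × True (defectingNbr? next v)
    stays-safe cv safe with toWitness {a? = defectingNbr? c v} safe
    ... | u , adj , cu = safe-defector-stays cv adj cu ,
                         fromWitness (u , adj , safe-defector-stays cu (adj-sym adj) cv)
    becomes-safe : c v ≡ C → next v ≡ D → True (defectingNbr? next v)
    becomes-safe cv turned = fromWitness (turning-collab-has-defecting-nbr cv turned)

  potential : Config n → ℕ
  potential c = sum (map (rank c) (allFin n))

  round-progress : ∀ c → (∀ v → c v ≡ step G w c v) ⊎ potential (step G w c) < potential c
  round-progress c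
    with sum-dominated (rank (step G w c)) (rank c) (proj₁ ∘ rank-step c) (allFin n)
  ... | inj₁ drop  = inj₂ drop
  ... | inj₂ agree = inj₁ λ v → ≡.sym (proj₂ (rank-step c v) (agree (∈-allFin v)))

  stabilises : ∀ c0 → BecomesStable G w c0
  stabilises c0 = descent (λ t → ∀ v → process G w c0 t v ≡ process G w c0 (suc t) v)
                          (potential ∘ process G w c0) (round-progress ∘ process G w c0)

two-labels⇒degree≤2 : ∀ {n} (G : Graph n) (label : Fin n → ℕ) →
  (∀ {x y} → label x ≡ label y → x ≡ y) → (a b : Fin n → ℕ) →
  (∀ v u → T (Adj G v u) → label u ≡ a v ⊎ label u ≡ b v) → ∀ v → degree G v ≤ 2
two-labels⇒degree≤2 {n} G label injective a b nbr-label v with degree G v ℕ.≤? 2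
... | yes ≤2 = ≤2
... | no  ≰2 with three-witnesses (Adj G v) (allFin⁺ n) (≰⇒> ≰2)
...   | x , y , z , (x≢y , x≢z , y≢z) , (vx , vy , vz) =
  ⊥-elim (pigeonhole (nbr-label v x vx) (nbr-label v y vy) (nbr-label v z vz))
  where
  same : ∀ {p q k} → label p ≡ k → label q ≡ k → p ≡ q
  same lp lq = injective (≡.trans lp (≡.sym lq))
  pigeonhole : label x ≡ a v ⊎ label x ≡ b v → label y ≡ a v ⊎ label y ≡ b v →
               label z ≡ a v ⊎ label z ≡ b v → ⊥
  pigeonhole (inj₁ lx) (inj₁ ly) _         = x≢y (same lx ly)
  pigeonhole (inj₂ lx) (inj₂ ly) _         = x≢y (same lx ly)
  pigeonhole (inj₁ lx) (inj₂ ly) (inj₁ lz) = x≢z (same lx lz)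
  pigeonhole (inj₁ lx) (inj₂ ly) (inj₂ lz) = y≢z (same ly lz)
  pigeonhole (inj₂ lx) (inj₁ ly) (inj₁ lz) = y≢z (same ly lz)
  pigeonhole (inj₂ lx) (inj₁ ly) (inj₂ lz) = x≢z (same lx lz)

copy-of-two-label-model : ∀ {n} (G : Graph n) (model : Fin n → Fin n → Bool) (a b : ℕ → ℕ) →
  (∀ i j → T (model i j) → toℕ j ≡ a (toℕ i) ⊎ toℕ j ≡ b (toℕ i)) →
  (σ : Fin n ↔ Fin n) → (∀ i j → Adj G i j ≡ model (Inverse.to σ i) (Inverse.to σ j)) →
  ∀ v → Neighbourhood.size G v ≤ 3
copy-of-two-label-model G model a b model-labels σ iso v =
  subst (_≤ 3) (≡.sym (Neighbourhood.size≡1+degree G v))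
    (s≤s (two-labels⇒degree≤2 G (toℕ ∘ to) (Injection.injective (↔⇒↣ σ) ∘ toℕ-injective)
      (a ∘ toℕ ∘ to) (b ∘ toℕ ∘ to) (λ i j adj → model-labels (to i) (to j) (subst T (iso i j) adj)) v))
  where
  to = Inverse.to σ

path-labels : ∀ n (i j : Fin n) → T (pathAdj n i j) → toℕ j ≡ suc (toℕ i) ⊎ toℕ j ≡ pred (toℕ i)
path-labels n i j adj with Equivalence.to T-∨ adj
... | inj₁ i+1≡j = inj₁ (≡.sym (≡ᵇ⇒≡ (suc (toℕ i)) (toℕ j) i+1≡j))
... | inj₂ j+1≡i = inj₂ (cong pred (≡ᵇ⇒≡ (suc (toℕ j)) (toℕ i) j+1≡i))

cycleSucc : ℕ → ℕ → ℕ
cycleSucc n i = if suc i ≡ᵇ n then 0 else suc i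

cyclePred : ℕ → ℕ → ℕ
cyclePred n zero    = pred n
cyclePred n (suc i) = i

cycleSucc-inner : ∀ {n i} → suc i < n → cycleSucc n i ≡ suc i
cycleSucc-inner {n} {i} i+1<n with suc i ≡ᵇ n | ≡ᵇ⇒≡ (suc i) n
... | true  | sound = ⊥-elim (<-irrefl (sound _) i+1<n)
... | false | _     = refl

cycleSucc-last : ∀ i → cycleSucc (suc i) i ≡ 0
cycleSucc-last i with suc i ≡ᵇ suc i | ≡⇒≡ᵇ (suc i) (suc i) refl
... | true  | _  = refl
... | false | ()

cycle-labels′ : ∀ {n i j} → j < n →
  T ((suc i ≡ᵇ j) ∨ (suc j ≡ᵇ i) ∨ ((i ≡ᵇ 0) ∧ (suc j ≡ᵇ n)) ∨ ((j ≡ᵇ 0) ∧ (suc i ≡ᵇ n))) →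
  j ≡ cycleSucc n i ⊎ j ≡ cyclePred n i
cycle-labels′ {n} {i} {j} j<n adj with Equivalence.to T-∨ adj
... | inj₁ i+1≡j with ≡ᵇ⇒≡ (suc i) j i+1≡j
...   | refl = inj₁ (≡.sym (cycleSucc-inner j<n))
cycle-labels′ {n} {i} {j} j<n adj | inj₂ adj′ with Equivalence.to T-∨ adj′
... | inj₁ j+1≡i with ≡ᵇ⇒≡ (suc j) i j+1≡i
...   | refl = inj₂ refl
cycle-labels′ {n} {i} {j} j<n adj | inj₂ adj′ | inj₂ adj″ with Equivalence.to T-∨ adj″
... | inj₁ wrap with Equivalence.to T-∧ wrap
...   | i≡0 , j+1≡n with ≡ᵇ⇒≡ i 0 i≡0 | ≡ᵇ⇒≡ (suc j) n j+1≡n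
...     | refl | refl = inj₂ refl
cycle-labels′ {n} {i} {j} j<n adj | inj₂ adj′ | inj₂ adj″ | inj₂ wrap with Equivalence.to T-∧ wrap
... | j≡0 , i+1≡n with ≡ᵇ⇒≡ j 0 j≡0 | ≡ᵇ⇒≡ (suc i) n i+1≡n
...   | refl | refl = inj₁ (≡.sym (cycleSucc-last i))

cycle-labels : ∀ n (i j : Fin n) → T (cycleAdj n i j) →
               toℕ j ≡ cycleSucc n (toℕ i) ⊎ toℕ j ≡ cyclePred n (toℕ i)
cycle-labels n i j = cycle-labels′ (toℕ<n j)

admissible : ∀ {n} (G : Graph n) → IsCycle G ⊎ IsPath G ⊎ Is3Regular G → Admissible G
admissible {n} G (inj₁ (_ , σ , iso)) =
  inj₁ (copy-of-two-label-model G (cycleAdj n) (cycleSucc n) (cyclePred n) (cycle-labels n) σ iso)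
admissible {n} G (inj₂ (inj₁ (_ , σ , iso))) =
  inj₁ (copy-of-two-label-model G (pathAdj n) suc pred (path-labels n) σ iso)
admissible G (inj₂ (inj₂ cubic)) =
  inj₂ λ v → ≡.trans (Neighbourhood.size≡1+degree G v) (cong suc (cubic v))

mainTheorem7 : {n : ℕ} (G : Graph n) → (IsCycle G ⊎ IsPath G ⊎ Is3Regular G) →
    (w : WinCondition) (c0 : Config n) → BecomesStable G w c0
mainTheorem7 G shape w c0 = Potential.stabilises G (admissible G shape) w c0
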